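{- Let $r\ge3$ be odd and $s=\frac{t^2+1}{t}\in\mathbb{F}_2(t)$. The polynomial $G(y)=y^2+\frac{t^{2r}+1}{t^r}y+1$ lies in $\mathbb{F}_2(s)[y]$ and is irreducible in $\mathbb{F}_2(s)[y]$.
   Context: $\mathbb{F}_2(s)$ is the subfield of $\mathbb{F}_2(t)$ generated by $s$. -}

module Defs where

open import Level using (0ℓ)
open import Algebra.Bundles.Raw using (RawRing)
open import Data.Bool using (Bool; true; false; _xor_; _∧_)
open import Data.List using (List; []; _∷_; map)
open import Data.List.Relation.Unary.All using (All)
open import Data.Nat using (ℕ; zero; suc) renaming (_*_ to _*ℕ_)
open import Data.Product using (_×_; _,_; proj₁; proj₂; Σ; ∃; ∃₂)
open import Data.Unit using (⊤)
open import Relation.Binary.PropositionalEquality using (_≡_)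
open import Relation.Nullary using (¬_)
open import Function using (id)

-- Polynomials (coefficient lists, lowest degree first) over a raw ring.
-- Equality is coefficientwise up to trailing zeros.

module Poly (R : RawRing 0ℓ 0ℓ) where
  open RawRing R renaming (Carrier to C; _+_ to _+ᶜ_; _*_ to _*ᶜ_; -_ to -ᶜ_; _≈_ to _≈ᶜ_)

  P : Set
  P = List C

  _≈ₚ_ : P → P → Set
  []       ≈ₚ []       = ⊤
  []       ≈ₚ (b ∷ bs) = (b ≈ᶜ 0#) × ([] ≈ₚ bs)
  (a ∷ as) ≈ₚ []       = (a ≈ᶜ 0#) × (as ≈ₚ [])
  (a ∷ as) ≈ₚ (b ∷ bs) = (a ≈ᶜ b) × (as ≈ₚ bs)

  _+ₚ_ : P → P → P
  []       +ₚ q        = q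
  (a ∷ p)  +ₚ []       = a ∷ p
  (a ∷ p)  +ₚ (b ∷ q)  = (a +ᶜ b) ∷ (p +ₚ q)

  _*ₚ_ : P → P → P
  []      *ₚ q = []
  (a ∷ p) *ₚ q = map (a *ᶜ_) q +ₚ (0# ∷ (p *ₚ q))

  -ₚ_ : P → P
  -ₚ_ = map -ᶜ_

  0ₚ : P
  0ₚ = []

  1ₚ : P
  1ₚ = 1# ∷ []

  X : P
  X = 0# ∷ 1# ∷ []

  _^ₚ_ : P → ℕ → P
  p ^ₚ zero  = 1ₚ
  p ^ₚ suc n = p *ₚ (p ^ₚ n)

  polyRing : RawRing 0ℓ 0ℓ
  polyRing = record
    { Carrier = P ; _≈_ = _≈ₚ_ ; _+_ = _+ₚ_ ; _*_ = _*ₚ_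
    ; -_ = -ₚ_ ; 0# = 0ₚ ; 1# = 1ₚ }

  -- For a subset K of the coefficients (a subring/subfield),
  -- the polynomials with all coefficients in K form K[y].
  InPolyOver : (C → Set) → P → Set
  InPolyOver K = All K

  IsUnit : (C → Set) → P → Set
  IsUnit K f = ∃ λ h → InPolyOver K h × ((f *ₚ h) ≈ₚ 1ₚ)

  Irreducible : (C → Set) → P → Set
  Irreducible K g =
    ¬ (g ≈ₚ 0ₚ) × ¬ IsUnit K g ×
    (∀ a b → InPolyOver K a → InPolyOver K b → g ≈ₚ (a *ₚ b) →
       IsUnit K a Data.Sum.⊎ IsUnit K b)
    where import Data.Sum

-- Fraction field of a raw ring (pairs numerator , denominator);
-- elements with zero denominator are junk and are excluded by the
-- predicates below.

module Frac (R : RawRing 0ℓ 0ℓ) where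
  open RawRing R

  fracRing : RawRing 0ℓ 0ℓ
  fracRing = record
    { Carrier = Carrier × Carrier
    ; _≈_ = λ x y → (proj₁ x * proj₂ y) ≈ (proj₁ y * proj₂ x)
    ; _+_ = λ x y → ((proj₁ x * proj₂ y) + (proj₁ y * proj₂ x)) , (proj₂ x * proj₂ y)
    ; _*_ = λ x y → (proj₁ x * proj₁ y) , (proj₂ x * proj₂ y)
    ; -_  = λ x → (- proj₁ x) , proj₂ x
    ; 0#  = 0# , 1#
    ; 1#  = 1# , 1# }

𝔽₂ : RawRing 0ℓ 0ℓ
𝔽₂ = record
  { Carrier = Bool ; _≈_ = _≡_ ; _+_ = _xor_ ; _*_ = _∧_
  ; -_ = id ; 0# = false ; 1# = true }

module T = Poly 𝔽₂           -- 𝔽₂[t] (also used for 𝔽₂[X])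

𝔽₂[t] : RawRing 0ℓ 0ℓ
𝔽₂[t] = T.polyRing

𝔽₂⟨t⟩ : RawRing 0ℓ 0ℓ
𝔽₂⟨t⟩ = Frac.fracRing 𝔽₂[t]

module F = RawRing 𝔽₂⟨t⟩

module Y = Poly 𝔽₂⟨t⟩

t : T.P
t = T.X

s : F.Carrier
s = ((t T.*ₚ t) T.+ₚ T.1ₚ) , t

ι : Bool → F.Carrier
ι b = (b ∷ []) , T.1ₚ

evalAtS : T.P → F.Carrier
evalAtS []       = F.0#
evalAtS (b ∷ bs) = ι b F.+ (s F.* evalAtS bs)

ValidF : F.Carrier → Set
ValidF f = ¬ (proj₂ f T.≈ₚ T.0ₚ)

In𝔽₂⟨s⟩ : F.Carrier → Set
In𝔽₂⟨s⟩ f = ValidF f × ∃₂ λ A B → ¬ (evalAtS B F.≈ F.0#) × ((f F.* evalAtS B) F.≈ evalAtS A)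

G : ℕ → Y.P
G r = F.1# ∷ (((t T.^ₚ (2 *ℕ r)) T.+ₚ T.1ₚ) , (t T.^ₚ r)) ∷ F.1# ∷ []

{-# OPTIONS --safe #-}
module Submission where

-- The roots of G in 𝔽₂(t) are t^r and t^-r: their product is 1 and their sum
-- is (t^2r + 1)/t^r.  If G = (a₀ + a₁y)(b₀ + b₁y) over 𝔽₂(s), then a₀b₁ is a
-- root, so t^r or t^-r lies in 𝔽₂(s).  But s = t + 1/t is fixed by t ↦ 1/t,
-- which forces the numerator and the denominator of every element of 𝔽₂(s)
-- to have the same weight ord + deg (lowest plus highest exponent of t):
-- for A of degree < n, t^n A(s) is a sum of the monomials t^(n-i) (t² + 1)^i,
-- all symmetric about t^n.  Since t^r/1 has weights 2r and 0, r = 0.  The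
-- middle coefficient t^r + t^-r is D_r(s) for the Dickson polynomial D_r.

open import Defs
open import Level using (0ℓ)
open import Algebra.Bundles using (CommutativeSemigroup; CommutativeRing)
open import Algebra.Bundles.Raw using (RawRing)
import Algebra.Properties.CommutativeSemigroup
import Algebra.Properties.Group
open import Data.Bool using (Bool; true; false; _xor_; _∧_)
import Data.Bool as Bool
open import Data.Bool.Properties
  using (xor-identityˡ; xor-identityʳ; xor-same; xor-comm; xor-assoc; ∧-zeroˡ; ∧-zeroʳ; ∧-comm; ∧-distribʳ-xor)
open import Data.Empty using (⊥; ⊥-elim)
open import Data.List using (List; []; _∷_; map; length)
open import Data.List.Relation.Unary.All using (All; []; _∷_)
import Data.List.Relation.Unary.All as All
open import Data.Maybe using (Maybe; just; nothing)
open import Data.Nat using (ℕ; zero; suc; _≤_; _<_; _%_; z≤n; s≤s) renaming (_+_ to _+ℕ_; _*_ to _*ℕ_)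
open import Data.Nat.Properties
  using (≤-refl; ≤-trans; m≤n+m; m≤n⇒m≤1+n; +-suc; +-cancelˡ-≡; +-cancelʳ-≡; m+n≡0⇒m≡0)
import Data.Nat.Properties as ℕ
open import Data.Product using (_×_; _,_; proj₁; proj₂; ∃; ∃₂)
open import Data.Sum using (_⊎_; inj₁; inj₂; [_,_])
import Data.Sum as Sum
open import Data.Unit using (⊤; tt)
open import Relation.Binary.PropositionalEquality
  using (_≡_; _≢_; refl; sym; trans; cong; cong₂; subst; module ≡-Reasoning)
import Relation.Binary.Reasoning.Setoid
open import Relation.Nullary using (¬_; Dec; yes; no)
open import Relation.Nullary.Decidable using (True; toWitness; map′)
open import Tactic.RingSolver using (solve-∀)
open import Tactic.RingSolver.Core.AlmostCommutativeRing using (AlmostCommutativeRing; fromCommutativeRing)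

-- Polynomials over a partial domain

-- The equality of a fraction field is transitive only through elements
-- with nonzero denominator, so the axioms are relativised to a predicate
-- of valid elements.
record IsPartialDomain (R : RawRing 0ℓ 0ℓ) (Valid : RawRing.Carrier R → Set) : Set where
  open RawRing R
  field
    ≈-refl           : ∀ {x} → x ≈ x
    ≈-sym            : ∀ {x y} → x ≈ y → y ≈ x
    ≈-trans          : ∀ {x y z} → Valid y → x ≈ y → y ≈ z → x ≈ z
    +-cong           : ∀ {x x′ y y′} → x ≈ x′ → y ≈ y′ → (x + y) ≈ (x′ + y′)
    *-cong           : ∀ {x x′ y y′} → x ≈ x′ → y ≈ y′ → (x * y) ≈ (x′ * y′)
    valid-0#         : Valid 0#
    valid-+          : ∀ {x y} → Valid x → Valid y → Valid (x + y)
    valid-*          : ∀ {x y} → Valid x → Valid y → Valid (x * y)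
    +-identityˡ      : ∀ x → (0# + x) ≈ x
    +-identityʳ      : ∀ x → (x + 0#) ≈ x
    zeroˡ            : ∀ x → (0# * x) ≈ 0#
    zeroʳ            : ∀ x → (x * 0#) ≈ 0#
    *-nonzero        : ∀ {x y} → Valid x → Valid y → ¬ x ≈ 0# → ¬ y ≈ 0# → ¬ (x * y) ≈ 0#
    ≈0?              : ∀ x → Dec (x ≈ 0#)

module Polynomials {R : RawRing 0ℓ 0ℓ} {Valid : RawRing.Carrier R → Set}
                   (D : IsPartialDomain R Valid) where
  open RawRing R renaming (Carrier to C)
  open IsPartialDomain D
  open Poly R

  coef : P → ℕ → C
  coef []      _       = 0#
  coef (a ∷ p) zero    = a
  coef (a ∷ p) (suc k) = coef p k

  -- A record rather than a function of p and q, so that both can be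
  -- inferred from p ≋ q.
  infix 4 _≋_
  record _≋_ (p q : P) : Set where
    constructor pw
    field at : ∀ k → coef p k ≈ coef q k
  open _≋_ public

  ≈ₚ⇒≋ : ∀ {p q} → p ≈ₚ q → p ≋ q
  ≈ₚ⇒≋ {p} {q} e = pw (go p q e)
    where
    go : ∀ p q → p ≈ₚ q → ∀ k → coef p k ≈ coef q k
    go []      []      _       k       = ≈-refl
    go []      (b ∷ q) (e , _) zero    = ≈-sym e
    go []      (b ∷ q) (_ , r) (suc k) = go [] q r k
    go (a ∷ p) []      (e , _) zero    = e
    go (a ∷ p) []      (_ , r) (suc k) = go p [] r k
    go (a ∷ p) (b ∷ q) (e , _) zero    = e
    go (a ∷ p) (b ∷ q) (_ , r) (suc k) = go p q r k

  ≋⇒≈ₚ : ∀ {p q} → p ≋ q → p ≈ₚ q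
  ≋⇒≈ₚ {p} {q} (pw f) = go p q f
    where
    go : ∀ p q → (∀ k → coef p k ≈ coef q k) → p ≈ₚ q
    go []      []      f = tt
    go []      (b ∷ q) f = ≈-sym (f zero) , go [] q (λ k → f (suc k))
    go (a ∷ p) []      f = f zero , go p [] (λ k → f (suc k))
    go (a ∷ p) (b ∷ q) f = f zero , go p q (λ k → f (suc k))

  ∷-cong : ∀ {a b p q} → a ≈ b → p ≋ q → (a ∷ p) ≋ (b ∷ q)
  ∷-cong e (pw f) = pw λ { zero → e ; (suc k) → f k }

  ∷-tail : ∀ {a b p q} → (a ∷ p) ≋ (b ∷ q) → p ≋ q
  ∷-tail (pw f) = pw λ k → f (suc k)

  coef-valid : ∀ {p} → All Valid p → ∀ k → Valid (coef p k)
  coef-valid []       k       = valid-0#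
  coef-valid (v ∷ vs) zero    = v
  coef-valid (v ∷ vs) (suc k) = coef-valid vs k

  ≋-refl : ∀ {p} → p ≋ p
  ≋-refl = pw λ k → ≈-refl

  ≋-sym : ∀ {p q} → p ≋ q → q ≋ p
  ≋-sym (pw f) = pw λ k → ≈-sym (f k)

  ≋-trans : ∀ {p q r} → All Valid q → p ≋ q → q ≋ r → p ≋ r
  ≋-trans vq (pw f) (pw g) = pw λ k → ≈-trans (coef-valid vq k) (f k) (g k)

  coef-+ₚ : ∀ p q k → coef (p +ₚ q) k ≈ (coef p k + coef q k)
  coef-+ₚ []      q       k       = ≈-sym (+-identityˡ _)
  coef-+ₚ (a ∷ p) []      k       = ≈-sym (+-identityʳ _)
  coef-+ₚ (a ∷ p) (b ∷ q) zero    = ≈-refl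
  coef-+ₚ (a ∷ p) (b ∷ q) (suc k) = coef-+ₚ p q k

  coef-map : ∀ a q k → coef (map (a *_) q) k ≈ (a * coef q k)
  coef-map a []      k       = ≈-sym (zeroʳ a)
  coef-map a (b ∷ q) zero    = ≈-refl
  coef-map a (b ∷ q) (suc k) = coef-map a q k

  valid-+ₚ : ∀ {p q} → All Valid p → All Valid q → All Valid (p +ₚ q)
  valid-+ₚ []       vq       = vq
  valid-+ₚ (v ∷ vp) []       = v ∷ vp
  valid-+ₚ (v ∷ vp) (w ∷ vq) = valid-+ v w ∷ valid-+ₚ vp vq

  valid-map : ∀ {a q} → Valid a → All Valid q → All Valid (map (a *_) q)
  valid-map va []       = []
  valid-map va (w ∷ vq) = valid-* va w ∷ valid-map va vq

  valid-*ₚ : ∀ {p q} → All Valid p → All Valid q → All Valid (p *ₚ q)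
  valid-*ₚ []       vq = []
  valid-*ₚ (v ∷ vp) vq = valid-+ₚ (valid-map v vq) (valid-0# ∷ valid-*ₚ vp vq)

  +ₚ-cong : ∀ {p p′ q q′} → All Valid p → All Valid p′ → All Valid q → All Valid q′ →
            p ≋ p′ → q ≋ q′ → (p +ₚ q) ≋ (p′ +ₚ q′)
  +ₚ-cong {p} {p′} {q} {q′} vp vp′ vq vq′ (pw f) (pw g) = pw λ k →
    ≈-trans (valid-+ (coef-valid vp k) (coef-valid vq k)) (coef-+ₚ p q k)
      (≈-trans (valid-+ (coef-valid vp′ k) (coef-valid vq′ k)) (+-cong (f k) (g k))
        (≈-sym (coef-+ₚ p′ q′ k)))

  map-cong : ∀ {a a′ q q′} → Valid a → Valid a′ → All Valid q → All Valid q′ →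
             a ≈ a′ → q ≋ q′ → map (a *_) q ≋ map (a′ *_) q′
  map-cong {a} {a′} {q} {q′} va va′ vq vq′ e (pw g) = pw λ k →
    ≈-trans (valid-* va (coef-valid vq k)) (coef-map a q k)
      (≈-trans (valid-* va′ (coef-valid vq′ k)) (*-cong e (g k)) (≈-sym (coef-map a′ q′ k)))

  ∷-zero : ∀ {a p} → a ≈ 0# → p ≋ [] → (a ∷ p) ≋ []
  ∷-zero e (pw f) = pw λ { zero → e ; (suc k) → f k }

  Vanishes : P → ℕ → Set
  Vanishes p n = ∀ k → n ≤ k → coef p k ≈ 0#

  map-vanishes : ∀ {a q n} → Valid a → All Valid q → Vanishes q n → Vanishes (map (a *_) q) n
  map-vanishes {a} {q} va vq v k n≤k =
    ≈-trans (valid-* va (coef-valid vq k)) (coef-map a q k)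
      (≈-trans (valid-* va valid-0#) (*-cong ≈-refl (v k n≤k)) (zeroʳ a))

  map-zeroˡ : ∀ {a q} → Valid a → All Valid q → a ≈ 0# → map (a *_) q ≋ []
  map-zeroˡ {a} {q} va vq e = pw λ k →
    ≈-trans (valid-* va (coef-valid vq k)) (coef-map a q k)
      (≈-trans (valid-* valid-0# (coef-valid vq k)) (*-cong e ≈-refl) (zeroˡ _))

  map-zeroʳ : ∀ {a q} → Valid a → All Valid q → q ≋ [] → map (a *_) q ≋ []
  map-zeroʳ va vq (pw z) = pw λ k → map-vanishes va vq (λ k _ → z k) k z≤n

  +ₚ-zero : ∀ {p q} → All Valid p → All Valid q → p ≋ [] → q ≋ [] → (p +ₚ q) ≋ []
  +ₚ-zero {p} {q} vp vq (pw f) (pw g) = pw λ k →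
    ≈-trans (valid-+ (coef-valid vp k) (coef-valid vq k)) (coef-+ₚ p q k)
      (≈-trans (valid-+ valid-0# valid-0#) (+-cong (f k) (g k)) (+-identityˡ 0#))

  +ₚ-identityʳ : ∀ {p q} → All Valid p → All Valid q → q ≋ [] → (p +ₚ q) ≋ p
  +ₚ-identityʳ {p} {q} vp vq (pw g) = pw λ k →
    ≈-trans (valid-+ (coef-valid vp k) (coef-valid vq k)) (coef-+ₚ p q k)
      (≈-trans (valid-+ (coef-valid vp k) valid-0#) (+-cong ≈-refl (g k)) (+-identityʳ _))

  *ₚ-zeroˡ : ∀ {p q} → All Valid p → All Valid q → p ≋ [] → (p *ₚ q) ≋ []
  *ₚ-zeroˡ {[]}    vp       vq z = ≋-refl
  *ₚ-zeroˡ {a ∷ p} (va ∷ vp) vq z =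
    +ₚ-zero (valid-map va vq) (valid-0# ∷ valid-*ₚ vp vq) (map-zeroˡ va vq (at z 0))
      (∷-zero ≈-refl (*ₚ-zeroˡ vp vq (pw λ k → at z (suc k))))

  *ₚ-zeroʳ : ∀ {p q} → All Valid p → All Valid q → q ≋ [] → (p *ₚ q) ≋ []
  *ₚ-zeroʳ {[]}    vp        vq z = ≋-refl
  *ₚ-zeroʳ {a ∷ p} (va ∷ vp) vq z =
    +ₚ-zero (valid-map va vq) (valid-0# ∷ valid-*ₚ vp vq) (map-zeroʳ va vq z)
      (∷-zero ≈-refl (*ₚ-zeroʳ vp vq z))

  *ₚ-cong : ∀ {p p′ q q′} → All Valid p → All Valid p′ → All Valid q → All Valid q′ →
            p ≋ p′ → q ≋ q′ → (p *ₚ q) ≋ (p′ *ₚ q′)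
  *ₚ-cong {[]}    {[]}     _         _           _  _   _ _ = ≋-refl
  *ₚ-cong {[]}    {_ ∷ _}  _         vp′         _  vq′ e _ = ≋-sym (*ₚ-zeroˡ vp′ vq′ (≋-sym e))
  *ₚ-cong {_ ∷ _} {[]}     vp        _           vq _   e _ = *ₚ-zeroˡ vp vq e
  *ₚ-cong {_ ∷ _} {_ ∷ _}  (va ∷ vp) (va′ ∷ vp′) vq vq′ e f =
    +ₚ-cong (valid-map va vq) (valid-map va′ vq′) (valid-0# ∷ valid-*ₚ vp vq) (valid-0# ∷ valid-*ₚ vp′ vq′)
      (map-cong va va′ vq vq′ (at e 0) f)
      (∷-cong ≈-refl (*ₚ-cong vp vp′ vq vq′ (∷-tail e) f))

  ≋[]? : ∀ p → Dec (p ≋ [])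
  ≋[]? []      = yes ≋-refl
  ≋[]? (a ∷ p) with ≈0? a | ≋[]? p
  ... | yes a≈0 | yes p≋0 = yes (∷-zero a≈0 p≋0)
  ... | no  a≉0 | _       = no λ z → a≉0 (at z 0)
  ... | yes _   | no  p≉0 = no λ z → p≉0 (pw λ k → at z (suc k))

  Degree : P → ℕ → Set
  Degree []      _       = ⊥
  Degree (a ∷ p) zero    = ¬ a ≈ 0# × p ≋ []
  Degree (a ∷ p) (suc d) = Degree p d

  degree-coef : ∀ {p d} → Degree p d → ¬ coef p d ≈ 0#
  degree-coef {a ∷ p} {zero}  (a≉0 , _) = a≉0
  degree-coef {a ∷ p} {suc d} deg       = degree-coef {p} deg

  degree-vanishes : ∀ {p d} → Degree p d → Vanishes p (suc d)
  degree-vanishes {a ∷ p} {zero}  (_ , pw z) (suc k) _         = z k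
  degree-vanishes {a ∷ p} {suc d} deg        (suc k) (s≤s d≤k) = degree-vanishes {p} deg k d≤k

  degree-resp : ∀ {p q d} → All Valid p → All Valid q → p ≋ q → Degree q d → Degree p d
  degree-resp {[]}    {b ∷ q} {zero}  _  _         e (b≉0 , _) = b≉0 (≈-sym (at e 0))
  degree-resp {[]}    {b ∷ q} {suc d} _  (_ ∷ vq)  e deg =
    degree-resp {[]} {q} {d} [] vq (pw λ k → at e (suc k)) deg
  degree-resp {a ∷ p} {b ∷ q} {zero}  (va ∷ vp) (vb ∷ vq) e (b≉0 , q≋0) =
    (λ a≈0 → b≉0 (≈-trans va (≈-sym (at e 0)) a≈0)) , ≋-trans vq (∷-tail e) q≋0
  degree-resp {a ∷ p} {b ∷ q} {suc d} (_ ∷ vp) (_ ∷ vq) e deg = degree-resp {p} {q} {d} vp vq (∷-tail e) deg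

  degree⇒nonzero : ∀ {p d} → All Valid p → Degree p d → ¬ p ≋ []
  degree⇒nonzero {p} {d} vp deg z = degree-resp {[]} {p} {d} [] vp (≋-sym z) deg

  degree-unique : ∀ {p d e} → Degree p d → Degree p e → d ≡ e
  degree-unique {a ∷ p} {zero}  {zero}  _          _   = refl
  degree-unique {a ∷ p} {zero}  {suc e} (_ , pw z) deg = ⊥-elim (degree-coef {p} deg (z e))
  degree-unique {a ∷ p} {suc d} {zero}  deg (_ , pw z) = ⊥-elim (degree-coef {p} deg (z d))
  degree-unique {a ∷ p} {suc d} {suc e} deg deg′      = cong suc (degree-unique {p} deg deg′)

  degree-exists : ∀ {p} → All Valid p → ¬ p ≋ [] → ∃ (Degree p)
  degree-exists {[]}    _        p≉0 = ⊥-elim (p≉0 ≋-refl)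
  degree-exists {a ∷ p} (_ ∷ vp) a∷p≉0 with ≋[]? p
  ... | yes p≋0 = zero , (λ a≈0 → a∷p≉0 (∷-zero a≈0 p≋0)) , p≋0
  ... | no  p≉0 = let (d , deg) = degree-exists vp p≉0 in suc d , deg

  degree-+ₚ : ∀ {p q d} → All Valid p → All Valid q → Vanishes p d → Degree q d → Degree (p +ₚ q) d
  degree-+ₚ {[]}    _         _         _ deg = deg
  degree-+ₚ {a ∷ p} {b ∷ q} {zero}  (va ∷ vp) (vb ∷ vq) v (b≉0 , q≋0) =
    (λ a+b≈0 → b≉0 (≈-trans (valid-+ valid-0# vb) (≈-sym (+-identityˡ b))
                     (≈-trans (valid-+ va vb) (+-cong (≈-sym (v 0 z≤n)) ≈-refl) a+b≈0))) ,
    +ₚ-zero vp vq (pw λ k → v (suc k) z≤n) q≋0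
  degree-+ₚ {a ∷ p} {b ∷ q} {suc d} (_ ∷ vp) (_ ∷ vq) v deg =
    degree-+ₚ {p} {q} {d} vp vq (λ k d≤k → v (suc k) (s≤s d≤k)) deg

  degree-map : ∀ {a q e} → Valid a → All Valid q → ¬ a ≈ 0# → Degree q e → Degree (map (a *_) q) e
  degree-map {a} {b ∷ q} {zero}  va (vb ∷ vq) a≉0 (b≉0 , q≋0) =
    *-nonzero va vb a≉0 b≉0 , map-zeroʳ va vq q≋0
  degree-map {a} {b ∷ q} {suc e} va (_ ∷ vq)  a≉0 deg = degree-map {a} {q} {e} va vq a≉0 deg

  degree-*ₚ : ∀ {p q d e} → All Valid p → All Valid q → Degree p d → Degree q e → Degree (p *ₚ q) (d +ℕ e)
  degree-*ₚ {a ∷ p} {q} {zero}  {e} (va ∷ vp) vq (a≉0 , p≋0) deg =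
    degree-resp (valid-*ₚ (va ∷ vp) vq) (valid-map va vq)
      (+ₚ-identityʳ (valid-map va vq) (valid-0# ∷ valid-*ₚ vp vq) (∷-zero ≈-refl (*ₚ-zeroˡ vp vq p≋0)))
      (degree-map {a} {q} {e} va vq a≉0 deg)
  degree-*ₚ {a ∷ p} {q} {suc d} {e} (va ∷ vp) vq deg deg′ =
    degree-+ₚ (valid-map va vq) (valid-0# ∷ valid-*ₚ vp vq)
      (λ k e<k → map-vanishes va vq (degree-vanishes {q} deg′) k (≤-trans (s≤s (m≤n+m e d)) e<k))
      (degree-*ₚ {p} {q} {d} {e} vp vq deg deg′)

  *ₚ-nonzero : ∀ {p q} → All Valid p → All Valid q → ¬ p ≋ [] → ¬ q ≋ [] → ¬ (p *ₚ q) ≋ []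
  *ₚ-nonzero vp vq p≉0 q≉0 with degree-exists vp p≉0 | degree-exists vq q≉0
  ... | (d , deg) | (e , deg′) = degree⇒nonzero (valid-*ₚ vp vq) (degree-*ₚ vp vq deg deg′)

  factor-degrees : ∀ {p a b n} → All Valid p → All Valid a → All Valid b → p ≋ (a *ₚ b) → Degree p n →
                   ∃₂ λ d e → Degree a d × Degree b e × d +ℕ e ≡ n
  factor-degrees {p} {a} {b} vp va vb p≋ab deg with ≋[]? a | ≋[]? b
  ... | yes a≋0 | _       = ⊥-elim (degree⇒nonzero vp deg (≋-trans (valid-*ₚ va vb) p≋ab (*ₚ-zeroˡ va vb a≋0)))
  ... | no _    | yes b≋0 = ⊥-elim (degree⇒nonzero vp deg (≋-trans (valid-*ₚ va vb) p≋ab (*ₚ-zeroʳ va vb b≋0)))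
  ... | no a≉0  | no b≉0  with degree-exists va a≉0 | degree-exists vb b≉0
  ...   | (d , deg-a) | (e , deg-b) =
    d , e , deg-a , deg-b ,
    degree-unique {a *ₚ b} (degree-*ₚ va vb deg-a deg-b) (degree-resp (valid-*ₚ va vb) vp (≋-sym p≋ab) deg)

-- The ring 𝔽₂[t]

𝔽₂-isPartialDomain : IsPartialDomain 𝔽₂ (λ _ → ⊤)
𝔽₂-isPartialDomain = record
  { ≈-refl = refl ; ≈-sym = sym ; ≈-trans = λ _ → trans
  ; +-cong = cong₂ _xor_ ; *-cong = cong₂ _∧_
  ; valid-0# = tt ; valid-+ = λ _ _ → tt ; valid-* = λ _ _ → tt
  ; +-identityˡ = xor-identityˡ ; +-identityʳ = xor-identityʳ
  ; zeroˡ = ∧-zeroˡ ; zeroʳ = ∧-zeroʳ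
  ; *-nonzero = λ {x} {y} _ _ → ∧-nonzero x y
  ; ≈0? = λ x → x Bool.≟ false }
  where
  ∧-nonzero : ∀ x y → x ≢ false → y ≢ false → x ∧ y ≢ false
  ∧-nonzero false _    x≢0 _   = x≢0
  ∧-nonzero true  false _  y≢0 = y≢0
  ∧-nonzero true  true  _  _   = λ ()

module TPoly = Polynomials 𝔽₂-isPartialDomain
open TPoly public using (coef; _≋_; pw; at; ≈ₚ⇒≋; ≋⇒≈ₚ; ≋-refl; ≋-sym; ∷-cong; ∷-zero; coef-+ₚ; coef-map;
                      ≋[]?; Degree; degree-vanishes; degree-unique)
open T using (P; _+ₚ_; _*ₚ_; -ₚ_; 1ₚ; _^ₚ_)

all-⊤ : ∀ (p : P) → All (λ _ → ⊤) p
all-⊤ []      = []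
all-⊤ (_ ∷ p) = tt ∷ all-⊤ p

≋-trans : ∀ {p q r} → p ≋ q → q ≋ r → p ≋ r
≋-trans {q = q} = TPoly.≋-trans (all-⊤ q)

+ₚ-cong : ∀ {p p′ q q′} → p ≋ p′ → q ≋ q′ → (p +ₚ q) ≋ (p′ +ₚ q′)
+ₚ-cong = TPoly.+ₚ-cong (all-⊤ _) (all-⊤ _) (all-⊤ _) (all-⊤ _)

*ₚ-cong : ∀ {p p′ q q′} → p ≋ p′ → q ≋ q′ → (p *ₚ q) ≋ (p′ *ₚ q′)
*ₚ-cong = TPoly.*ₚ-cong (all-⊤ _) (all-⊤ _) (all-⊤ _) (all-⊤ _)

+ₚ-comm : ∀ p q → (p +ₚ q) ≋ (q +ₚ p)
+ₚ-comm p q = pw λ k → trans (coef-+ₚ p q k) (trans (xor-comm (coef p k) (coef q k)) (sym (coef-+ₚ q p k)))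

+ₚ-assoc : ∀ p q r → ((p +ₚ q) +ₚ r) ≋ (p +ₚ (q +ₚ r))
+ₚ-assoc p q r = pw λ k → begin
  coef ((p +ₚ q) +ₚ r) k               ≡⟨ trans (coef-+ₚ (p +ₚ q) r k) (cong (_xor coef r k) (coef-+ₚ p q k)) ⟩
  (coef p k xor coef q k) xor coef r k ≡⟨ xor-assoc (coef p k) (coef q k) (coef r k) ⟩
  coef p k xor (coef q k xor coef r k) ≡⟨ sym (trans (coef-+ₚ p (q +ₚ r) k) (cong (coef p k xor_) (coef-+ₚ q r k))) ⟩
  coef (p +ₚ (q +ₚ r)) k               ∎
  where open ≡-Reasoning

+ₚ-identityʳ : ∀ p → (p +ₚ []) ≋ p
+ₚ-identityʳ p = TPoly.+ₚ-identityʳ (all-⊤ p) [] ≋-refl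

+ₚ-commutativeSemigroup : CommutativeSemigroup 0ℓ 0ℓ
+ₚ-commutativeSemigroup = record
  { Carrier = P ; _≈_ = _≋_ ; _∙_ = _+ₚ_
  ; isCommutativeSemigroup = record
    { isSemigroup = record
      { isMagma = record
        { isEquivalence = record { refl = ≋-refl ; sym = ≋-sym ; trans = ≋-trans }
        ; ∙-cong = +ₚ-cong }
      ; assoc = +ₚ-assoc }
    ; comm = +ₚ-comm } }

module +ₚ = Algebra.Properties.CommutativeSemigroup +ₚ-commutativeSemigroup

coef-neg : ∀ p k → coef (-ₚ p) k ≡ coef p k
coef-neg []      k       = refl
coef-neg (_ ∷ p) zero    = refl
coef-neg (_ ∷ p) (suc k) = coef-neg p k

-ₚ-cong : ∀ {p q} → p ≋ q → (-ₚ p) ≋ (-ₚ q)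
-ₚ-cong {p} {q} (pw f) = pw λ k → trans (coef-neg p k) (trans (f k) (sym (coef-neg q k)))

-ₚ-inverseʳ : ∀ p → (p +ₚ (-ₚ p)) ≋ []
-ₚ-inverseʳ p = pw λ k → trans (coef-+ₚ p (-ₚ p) k) (trans (cong (coef p k xor_) (coef-neg p k)) (xor-same (coef p k)))

-ₚ-inverseˡ : ∀ p → ((-ₚ p) +ₚ p) ≋ []
-ₚ-inverseˡ p = ≋-trans (+ₚ-comm (-ₚ p) p) (-ₚ-inverseʳ p)

map-false : ∀ q → map (false ∧_) q ≋ []
map-false q = pw (coef-map false q)

map-true : ∀ q → map (true ∧_) q ≋ q
map-true q = pw (coef-map true q)

map-xor : ∀ a b r → map ((a xor b) ∧_) r ≋ (map (a ∧_) r +ₚ map (b ∧_) r)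
map-xor a b r = pw λ k → trans (coef-map (a xor b) r k) (trans (∧-distribʳ-xor (coef r k) a b)
  (sym (trans (coef-+ₚ (map (a ∧_) r) (map (b ∧_) r) k) (cong₂ _xor_ (coef-map a r k) (coef-map b r k)))))

*ₚ-distribʳ : ∀ p q r → ((p +ₚ q) *ₚ r) ≋ ((p *ₚ r) +ₚ (q *ₚ r))
*ₚ-distribʳ []      q       r = ≋-refl
*ₚ-distribʳ (a ∷ p) []      r = ≋-sym (+ₚ-identityʳ _)
*ₚ-distribʳ (a ∷ p) (b ∷ q) r =
  ≋-trans (+ₚ-cong (map-xor a b r) (∷-cong refl (*ₚ-distribʳ p q r)))
    (+ₚ.interchange (map (a ∧_) r) (map (b ∧_) r) (false ∷ (p *ₚ r)) (false ∷ (q *ₚ r)))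

*ₚ-zeroʳ : ∀ p → (p *ₚ []) ≋ []
*ₚ-zeroʳ p = TPoly.*ₚ-zeroʳ (all-⊤ p) [] ≋-refl

*ₚ-∷ʳ : ∀ p b q → (p *ₚ (b ∷ q)) ≋ (map (b ∧_) p +ₚ (false ∷ (p *ₚ q)))
*ₚ-∷ʳ []      b q = ≋-sym (∷-zero refl ≋-refl)
*ₚ-∷ʳ (a ∷ p) b q =
  ∷-cong (trans (xor-identityʳ _) (trans (∧-comm a b) (sym (xor-identityʳ _))))
    (≋-trans (+ₚ-cong (≋-refl {map (a ∧_) q}) (*ₚ-∷ʳ p b q))
      (+ₚ.x∙yz≈y∙xz (map (a ∧_) q) (map (b ∧_) p) (false ∷ (p *ₚ q))))

*ₚ-comm : ∀ p q → (p *ₚ q) ≋ (q *ₚ p)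
*ₚ-comm []      q = ≋-sym (*ₚ-zeroʳ q)
*ₚ-comm (a ∷ p) q =
  ≋-trans (+ₚ-cong (≋-refl {map (a ∧_) q}) (∷-cong refl (*ₚ-comm p q))) (≋-sym (*ₚ-∷ʳ q a p))

false∷-*ₚ : ∀ p q → ((false ∷ p) *ₚ q) ≋ (false ∷ (p *ₚ q))
false∷-*ₚ p q = +ₚ-cong (map-false q) (≋-refl {false ∷ (p *ₚ q)})

map-*ₚ : ∀ a q r → (map (a ∧_) q *ₚ r) ≋ map (a ∧_) (q *ₚ r)
map-*ₚ false q r = ≋-trans (*ₚ-cong (map-false q) (≋-refl {r})) (≋-sym (map-false (q *ₚ r)))
map-*ₚ true  q r = ≋-trans (*ₚ-cong (map-true q) (≋-refl {r})) (≋-sym (map-true (q *ₚ r)))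

*ₚ-assoc : ∀ p q r → ((p *ₚ q) *ₚ r) ≋ (p *ₚ (q *ₚ r))
*ₚ-assoc []      q r = ≋-refl
*ₚ-assoc (a ∷ p) q r =
  ≋-trans (*ₚ-distribʳ (map (a ∧_) q) (false ∷ (p *ₚ q)) r)
    (+ₚ-cong (map-*ₚ a q r) (≋-trans (false∷-*ₚ (p *ₚ q) r) (∷-cong refl (*ₚ-assoc p q r))))

*ₚ-identityˡ : ∀ p → (1ₚ *ₚ p) ≋ p
*ₚ-identityˡ p =
  ≋-trans (+ₚ-cong (map-true p) (≋-refl {false ∷ []})) (TPoly.+ₚ-identityʳ (all-⊤ p) (tt ∷ []) (∷-zero refl ≋-refl))

*ₚ-identityʳ : ∀ p → (p *ₚ 1ₚ) ≋ p
*ₚ-identityʳ p = ≋-trans (*ₚ-comm p 1ₚ) (*ₚ-identityˡ p)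

*ₚ-distribˡ : ∀ p q r → (p *ₚ (q +ₚ r)) ≋ ((p *ₚ q) +ₚ (p *ₚ r))
*ₚ-distribˡ p q r =
  ≋-trans (*ₚ-comm p (q +ₚ r)) (≋-trans (*ₚ-distribʳ q r p) (+ₚ-cong (*ₚ-comm q p) (*ₚ-comm r p)))

𝔽₂[t]-commutativeRing : CommutativeRing 0ℓ 0ℓ
𝔽₂[t]-commutativeRing = record
  { Carrier = P ; _≈_ = _≋_ ; _+_ = _+ₚ_ ; _*_ = _*ₚ_ ; -_ = -ₚ_ ; 0# = [] ; 1# = 1ₚ
  ; isCommutativeRing = record
    { isRing = record
      { +-isAbelianGroup = record
        { isGroup = record
          { isMonoid = record
            { isSemigroup = CommutativeSemigroup.isSemigroup +ₚ-commutativeSemigroup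
            ; identity = (λ _ → ≋-refl) , +ₚ-identityʳ }
          ; inverse = -ₚ-inverseˡ , -ₚ-inverseʳ
          ; ⁻¹-cong = -ₚ-cong }
        ; comm = +ₚ-comm }
      ; *-cong = *ₚ-cong
      ; *-assoc = *ₚ-assoc
      ; *-identity = *ₚ-identityˡ , *ₚ-identityʳ
      ; distrib = *ₚ-distribˡ , (λ x y z → *ₚ-distribʳ y z x) }
    ; *-comm = *ₚ-comm } }

-- Without a zero test the ring solver cannot cancel terms such as x - x.
[]≋? : ∀ p → Maybe ([] ≋ p)
[]≋? p with ≋[]? p
... | yes p≋0 = just (≋-sym p≋0)
... | no  _   = nothing

𝔽₂[t]-almostCommutativeRing : AlmostCommutativeRing 0ℓ 0ℓ
𝔽₂[t]-almostCommutativeRing = fromCommutativeRing 𝔽₂[t]-commutativeRing []≋?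

-- The ring solver only recognises these names; they unfold to _+ₚ_, _*ₚ_, -ₚ_, [], 1ₚ and _≋_.
open AlmostCommutativeRing 𝔽₂[t]-almostCommutativeRing using (_+_; _*_; _-_; -_; 0#; 1#; _≈_)

module ≋-Reasoning = Relation.Binary.Reasoning.Setoid (CommutativeRing.setoid 𝔽₂[t]-commutativeRing)
open CommutativeRing 𝔽₂[t]-commutativeRing using () renaming (reflexive to ≋-reflexive)

module ℕ+ = Algebra.Properties.CommutativeSemigroup ℕ.+-commutativeSemigroup

module +ₚ-Group = Algebra.Properties.Group (CommutativeRing.+-group 𝔽₂[t]-commutativeRing)

*ₚ-nonzero : ∀ {p q} → ¬ p ≋ [] → ¬ q ≋ [] → ¬ (p *ₚ q) ≋ []
*ₚ-nonzero = TPoly.*ₚ-nonzero (all-⊤ _) (all-⊤ _)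

zero-product : ∀ {p q} → (p *ₚ q) ≋ [] → p ≋ [] ⊎ q ≋ []
zero-product {p} {q} pq≋0 with ≋[]? p | ≋[]? q
... | yes p≋0 | _       = inj₁ p≋0
... | no  _   | yes q≋0 = inj₂ q≋0
... | no  p≉0 | no  q≉0 = ⊥-elim (*ₚ-nonzero p≉0 q≉0 pq≋0)

*ₚ-cancelʳ : ∀ {p q r} → ¬ r ≋ [] → (p *ₚ r) ≋ (q *ₚ r) → p ≋ q
*ₚ-cancelʳ {p} {q} {r} r≉0 pr≋qr =
  [ +ₚ-Group.x∙y⁻¹≈ε⇒x≈y p q , (λ r≋0 → ⊥-elim (r≉0 r≋0)) ]
    (zero-product (≋-trans (distrib p q r) (+ₚ-Group.x≈y⇒x∙y⁻¹≈ε pr≋qr)))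
  where
  distrib : ∀ x y z → ((x - y) * z) ≈ ((x * z) - (y * z))
  distrib = solve-∀ 𝔽₂[t]-almostCommutativeRing

_≋?_ : ∀ p q → Dec (p ≋ q)
p ≋? q = map′ (+ₚ-Group.x∙y⁻¹≈ε⇒x≈y p q) +ₚ-Group.x≈y⇒x∙y⁻¹≈ε (≋[]? (p +ₚ (-ₚ q)))

by-decision : ∀ {p q} → True (p ≋? q) → p ≋ q
by-decision = toWitness

-ₚ≋id : ∀ p → (-ₚ p) ≋ p
-ₚ≋id p = pw (coef-neg p)

-- Order and weight

Ord : P → ℕ → Set
Ord []      _       = ⊥
Ord (a ∷ p) zero    = a ≡ true
Ord (a ∷ p) (suc l) = a ≡ false × Ord p l

ord-coef : ∀ {p l} → Ord p l → coef p l ≡ true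
ord-coef {a ∷ p} {zero}  a≡1       = a≡1
ord-coef {a ∷ p} {suc l} (_ , ord) = ord-coef {p} ord

ord⇒nonzero : ∀ {p l} → Ord p l → ¬ p ≋ []
ord⇒nonzero {p} {l} ord p≋0 with trans (sym (ord-coef {p} ord)) (at p≋0 l)
... | ()

ord-resp : ∀ {p q l} → p ≋ q → Ord q l → Ord p l
ord-resp {[]}    {b ∷ q} {zero}  e b≡1 with trans (at e 0) b≡1
... | ()
ord-resp {[]}    {b ∷ q} {suc l} e (_ , ord)   = ord-resp {[]} {q} (pw λ k → at e (suc k)) ord
ord-resp {a ∷ p} {b ∷ q} {zero}  e b≡1         = trans (at e 0) b≡1
ord-resp {a ∷ p} {b ∷ q} {suc l} e (b≡0 , ord) = trans (at e 0) b≡0 , ord-resp {p} {q} (TPoly.∷-tail e) ord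

ord-exists : ∀ p → ¬ p ≋ [] → ∃ (Ord p)
ord-exists []           p≉0 = ⊥-elim (p≉0 ≋-refl)
ord-exists (true ∷ p)   _   = zero , refl
ord-exists (false ∷ p)  p≉0 =
  let (l , ord) = ord-exists p (λ p≋0 → p≉0 (∷-zero refl p≋0)) in suc l , refl , ord

ord-unique : ∀ {p l m} → Ord p l → Ord p m → l ≡ m
ord-unique {a ∷ p} {zero}  {zero}  _        _        = refl
ord-unique {a ∷ p} {zero}  {suc m} refl     (() , _)
ord-unique {a ∷ p} {suc l} {zero}  (() , _) refl
ord-unique {a ∷ p} {suc l} {suc m} (_ , o)  (_ , o′) = cong suc (ord-unique {p} o o′)

ord-*ₚ-unit : ∀ q m r → Ord q m → Ord (q *ₚ (true ∷ r)) m
ord-*ₚ-unit (true ∷ q)  zero    r refl        = refl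
ord-*ₚ-unit (false ∷ q) (suc m) r (refl , o)  = ord-resp (false∷-*ₚ q (true ∷ r)) (refl , ord-*ₚ-unit q m r o)

ord-*ₚ : ∀ p q l m → Ord p l → Ord q m → Ord (p *ₚ q) (l +ℕ m)
ord-*ₚ (false ∷ p) q (suc l) m (refl , o) o′ = ord-resp (false∷-*ₚ p q) (refl , ord-*ₚ p q l m o o′)
ord-*ₚ (true ∷ p)  q zero    m refl       o′ = ord-resp (*ₚ-comm (true ∷ p) q) (ord-*ₚ-unit q m p o′)

ord-+ₚ : ∀ p q l m → Ord p l → Ord q m → l < m → Ord (p +ₚ q) l
ord-+ₚ (true ∷ p)  []      zero    m       o          _          _         = o
ord-+ₚ (true ∷ p)  (b ∷ q) zero    (suc m) refl       (refl , _) _         = refl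
ord-+ₚ (false ∷ p) []      (suc l) m       o          _          _         = o
ord-+ₚ (false ∷ p) (b ∷ q) (suc l) (suc m) (refl , o) (refl , o′) (s≤s l<m) = refl , ord-+ₚ p q l m o o′ l<m

Weight : P → ℕ → Set
Weight p w = ∃₂ λ l d → Ord p l × Degree p d × l +ℕ d ≡ w

weight-resp : ∀ {p q w} → p ≋ q → Weight q w → Weight p w
weight-resp e (l , d , o , deg , eq) = l , d , ord-resp e o , TPoly.degree-resp (all-⊤ _) (all-⊤ _) e deg , eq

weight-unique : ∀ {p w v} → Weight p w → Weight p v → w ≡ v
weight-unique {p} (l , d , o , deg , refl) (l′ , d′ , o′ , deg′ , refl) =
  cong₂ _+ℕ_ (ord-unique {p} o o′) (degree-unique {p} deg deg′)

weight⇒nonzero : ∀ {p w} → Weight p w → ¬ p ≋ []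
weight⇒nonzero {p} (l , _ , o , _) = ord⇒nonzero {p} {l} o

weight-exists : ∀ p → ¬ p ≋ [] → ∃ (Weight p)
weight-exists p p≉0 with ord-exists p p≉0 | TPoly.degree-exists (all-⊤ p) p≉0
... | (l , o) | (d , deg) = l +ℕ d , l , d , o , deg , refl

weight-*ₚ : ∀ {p q w v} → Weight p w → Weight q v → Weight (p *ₚ q) (w +ℕ v)
weight-*ₚ {p} {q} (l , d , o , deg , refl) (l′ , d′ , o′ , deg′ , refl) =
  l +ℕ l′ , d +ℕ d′ , ord-*ₚ p q l l′ o o′ , TPoly.degree-*ₚ (all-⊤ p) (all-⊤ q) deg deg′ ,
  ℕ+.interchange l l′ d d′

t*ₚ : ∀ q → (t *ₚ q) ≋ (false ∷ q)
t*ₚ q = ≋-trans (false∷-*ₚ (true ∷ []) q) (∷-cong refl (*ₚ-identityˡ q))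

t^-ord-degree : ∀ k → Ord (t ^ₚ k) k × Degree (t ^ₚ k) k
t^-ord-degree zero    = refl , (λ ()) , ≋-refl
t^-ord-degree (suc k) =
  ord-resp (t*ₚ (t ^ₚ k)) (refl , proj₁ (t^-ord-degree k)) ,
  TPoly.degree-resp (all-⊤ _) (all-⊤ _) (t*ₚ (t ^ₚ k)) (proj₂ (t^-ord-degree k))

t^-weight : ∀ k → Weight (t ^ₚ k) (k +ℕ k)
t^-weight k = k , k , proj₁ (t^-ord-degree k) , proj₂ (t^-ord-degree k) , refl

t^-+ : ∀ m n → (t ^ₚ (m +ℕ n)) ≋ ((t ^ₚ m) *ₚ (t ^ₚ n))
t^-+ zero    n = ≋-sym (*ₚ-identityˡ _)
t^-+ (suc m) n = ≋-trans (*ₚ-cong (≋-refl {t}) (t^-+ m n)) (≋-sym (*ₚ-assoc t (t ^ₚ m) (t ^ₚ n)))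

t^-double : ∀ r → (t ^ₚ (2 *ℕ r)) ≋ ((t ^ₚ r) *ₚ (t ^ₚ r))
t^-double r = ≋-trans (t^-+ r (r +ℕ 0)) (*ₚ-cong (≋-refl {t ^ₚ r}) (≋-reflexive (cong (t ^ₚ_) (ℕ.+-identityʳ r))))

-- Elements of 𝔽₂(s) are balanced

numerator denominator : List Bool → P
numerator   B = proj₁ (evalAtS B)
denominator B = proj₂ (evalAtS B)

denominator-t^ : ∀ B → denominator B ≋ (t ^ₚ length B)
denominator-t^ []      = ≋-refl
denominator-t^ (b ∷ B) = ≋-trans (*ₚ-identityˡ _) (*ₚ-cong (≋-refl {t}) (denominator-t^ B))

numerator-∷ : ∀ b B → numerator (b ∷ B) ≋ (((b ∷ []) *ₚ (t ^ₚ suc (length B))) +ₚ (proj₁ s *ₚ numerator B))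
numerator-∷ b B =
  +ₚ-cong (*ₚ-cong (≋-refl {b ∷ []}) (*ₚ-cong (≋-refl {t}) (denominator-t^ B))) (*ₚ-identityʳ _)

numerator-false∷ : ∀ B → numerator (false ∷ B) ≋ (proj₁ s *ₚ numerator B)
numerator-false∷ B = ≋-trans (numerator-∷ false B) (+ₚ-cong 0*T (≋-refl {proj₁ s *ₚ numerator B}))
  where
  0*T : ((false ∷ []) *ₚ (t ^ₚ suc (length B))) ≋ []
  0*T = ≋-trans (false∷-*ₚ [] _) (∷-zero refl ≋-refl)

numerator-true∷ : ∀ B → numerator (true ∷ B) ≋ ((t ^ₚ suc (length B)) +ₚ (proj₁ s *ₚ numerator B))
numerator-true∷ B =
  ≋-trans (numerator-∷ true B) (+ₚ-cong (*ₚ-identityˡ (t ^ₚ suc (length B))) (≋-refl {proj₁ s *ₚ numerator B}))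

Centred : P → ℕ → Set
Centred p n = p ≋ [] ⊎ ∃₂ λ l d → Ord p l × Degree p d × l ≤ n × n ≤ d × l +ℕ d ≡ n +ℕ n

centred-resp : ∀ {p q n} → p ≋ q → Centred q n → Centred p n
centred-resp e (inj₁ q≋0)                        = inj₁ (≋-trans e q≋0)
centred-resp e (inj₂ (l , d , o , deg , bounds)) =
  inj₂ (l , d , ord-resp e o , TPoly.degree-resp (all-⊤ _) (all-⊤ _) e deg , bounds)

s*ₚ-ord-degree : ∀ {p l d} → Ord p l → Degree p d → Ord (proj₁ s *ₚ p) l × Degree (proj₁ s *ₚ p) (2 +ℕ d)
s*ₚ-ord-degree {p} {l} {d} o deg =
  ord-*ₚ (proj₁ s) p 0 l refl o ,
  TPoly.degree-*ₚ {proj₁ s} {p} {2} {d} (all-⊤ _) (all-⊤ p) ((λ ()) , ≋-refl {[]}) deg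

centred-step : ∀ {l d n} → l +ℕ d ≡ n +ℕ n → l +ℕ (2 +ℕ d) ≡ suc n +ℕ suc n
centred-step {l} {d} {n} eq =
  trans (+-suc l (suc d)) (cong suc (trans (+-suc l d) (trans (cong suc eq) (sym (+-suc n n)))))

s*ₚ-centred : ∀ {p n} → Centred p n → Centred (proj₁ s *ₚ p) (suc n)
s*ₚ-centred (inj₁ p≋0) = inj₁ (≋-trans (*ₚ-cong (≋-refl {proj₁ s}) p≋0) (*ₚ-zeroʳ (proj₁ s)))
s*ₚ-centred (inj₂ (l , d , o , deg , l≤n , n≤d , eq)) =
  let (o′ , deg′) = s*ₚ-ord-degree o deg in
  inj₂ (l , 2 +ℕ d , o′ , deg′ , m≤n⇒m≤1+n l≤n , s≤s (m≤n⇒m≤1+n n≤d) , centred-step eq)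

t^+s*ₚ-centred : ∀ {p n} → Centred p n → Centred ((t ^ₚ suc n) +ₚ (proj₁ s *ₚ p)) (suc n)
t^+s*ₚ-centred {p} {n} (inj₁ p≋0) =
  inj₂ (suc n , suc n , ord-resp e (proj₁ (t^-ord-degree (suc n))) ,
        TPoly.degree-resp (all-⊤ _) (all-⊤ _) e (proj₂ (t^-ord-degree (suc n))) , ≤-refl , ≤-refl , refl)
  where
  e : ((t ^ₚ suc n) +ₚ (proj₁ s *ₚ p)) ≋ (t ^ₚ suc n)
  e = ≋-trans (+ₚ-cong (≋-refl {t ^ₚ suc n}) (≋-trans (*ₚ-cong (≋-refl {proj₁ s}) p≋0) (*ₚ-zeroʳ (proj₁ s))))
              (+ₚ-identityʳ _)
t^+s*ₚ-centred {p} {n} (inj₂ (l , d , o , deg , l≤n , n≤d , eq)) =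
  inj₂ (l , 2 +ℕ d ,
        ord-resp (+ₚ-comm (t ^ₚ suc n) (proj₁ s *ₚ p))
          (ord-+ₚ (proj₁ s *ₚ p) (t ^ₚ suc n) l (suc n) o′ (proj₁ (t^-ord-degree (suc n))) (s≤s l≤n)) ,
        TPoly.degree-+ₚ {t ^ₚ suc n} {proj₁ s *ₚ p} (all-⊤ _) (all-⊤ _)
          (λ k 2+d≤k → degree-vanishes {t ^ₚ suc n} (proj₂ (t^-ord-degree (suc n))) k
                         (≤-trans (s≤s (s≤s n≤d)) 2+d≤k))
          deg′ ,
        m≤n⇒m≤1+n l≤n , s≤s (m≤n⇒m≤1+n n≤d) , centred-step eq)
  where
  o′   = proj₁ (s*ₚ-ord-degree o deg)
  deg′ = proj₂ (s*ₚ-ord-degree o deg)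

numerator-centred : ∀ B → Centred (numerator B) (length B)
numerator-centred []          = inj₁ ≋-refl
numerator-centred (false ∷ B) = centred-resp (numerator-false∷ B) (s*ₚ-centred (numerator-centred B))
numerator-centred (true ∷ B)  = centred-resp (numerator-true∷ B) (t^+s*ₚ-centred (numerator-centred B))

numerator-weight : ∀ B → ¬ numerator B ≋ [] → Weight (numerator B) (length B +ℕ length B)
numerator-weight B N≉0 with numerator-centred B
... | inj₁ N≋0                         = ⊥-elim (N≉0 N≋0)
... | inj₂ (l , d , o , deg , _ , _ , eq) = l , d , o , deg , eq

denominator-weight : ∀ B → Weight (denominator B) (length B +ℕ length B)
denominator-weight B = weight-resp (denominator-t^ B) (t^-weight (length B))

≉F0⇒numerator≉0 : ∀ {x} → ¬ (x F.≈ F.0#) → ¬ proj₁ x ≋ []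
≉F0⇒numerator≉0 x≉0 n≋0 = x≉0 (≋⇒≈ₚ (≋-trans (*ₚ-identityʳ _) n≋0))

≈F0⇒numerator≋0 : ∀ {x} → x F.≈ F.0# → proj₁ x ≋ []
≈F0⇒numerator≋0 x≈0 = ≋-trans (≋-sym (*ₚ-identityʳ _)) (≈ₚ⇒≋ x≈0)

ValidF⇒denominator≉0 : ∀ {x} → ValidF x → ¬ proj₂ x ≋ []
ValidF⇒denominator≉0 valid d≋0 = valid (≋⇒≈ₚ d≋0)

numerator-of-A≉0 : ∀ {n d} A B → ¬ n ≋ [] → ¬ numerator B ≋ [] →
  ((n *ₚ numerator B) *ₚ denominator A) ≋ (numerator A *ₚ (d *ₚ denominator B)) → ¬ numerator A ≋ []
numerator-of-A≉0 {n} {d} A B n≉0 NB≉0 eq NA≋0 =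
  *ₚ-nonzero (*ₚ-nonzero n≉0 NB≉0) (weight⇒nonzero (denominator-weight A))
    (≋-trans eq (TPoly.*ₚ-zeroˡ (all-⊤ _) (all-⊤ _) NA≋0))

Balanced : F.Carrier → Set
Balanced (n , d) = ∃ λ w → Weight n w × Weight d w

in𝔽₂⟨s⟩⇒balanced : ∀ {n d} → In𝔽₂⟨s⟩ (n , d) → ¬ n ≋ [] → Balanced (n , d)
in𝔽₂⟨s⟩⇒balanced {n} {d} (valid , A , B , B≉0 , eq) n≉0
  with weight-exists n n≉0 | weight-exists d (ValidF⇒denominator≉0 {n , d} valid)
... | (wn , Wn) | (wd , Wd) = wn , Wn , subst (Weight d) (sym wn≡wd) Wd
  where
  eq′ = ≈ₚ⇒≋ eq
  NB≉0 = ≉F0⇒numerator≉0 {evalAtS B} B≉0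
  NA≉0 = numerator-of-A≉0 {n} {d} A B n≉0 NB≉0 eq′
  a = length A +ℕ length A
  b = length B +ℕ length B
  wn≡wd : wn ≡ wd
  wn≡wd = +-cancelʳ-≡ b wn wd (+-cancelʳ-≡ a (wn +ℕ b) (wd +ℕ b) (trans
    (weight-unique (weight-*ₚ (weight-*ₚ Wn (numerator-weight B NB≉0)) (denominator-weight A))
                   (weight-resp eq′ (weight-*ₚ (numerator-weight A NA≉0) (weight-*ₚ Wd (denominator-weight B)))))
    (ℕ.+-comm a (wd +ℕ b))))

balanced-* : ∀ {x y} → Balanced x → Balanced y → Balanced (x F.* y)
balanced-* (w , Wn , Wd) (v , Wn′ , Wd′) = w +ℕ v , weight-*ₚ Wn Wn′ , weight-*ₚ Wd Wd′

same-weight-×t^r⇒r≡0 : ∀ {p q w r} → Weight p w → Weight q w → p ≋ (q *ₚ (t ^ₚ r)) → r ≡ 0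
same-weight-×t^r⇒r≡0 {r = r} Wp Wq p≋qt^r =
  m+n≡0⇒m≡0 r (+-cancelˡ-≡ _ (r +ℕ r) 0
    (trans (sym (weight-unique Wp (weight-resp p≋qt^r (weight-*ₚ Wq (t^-weight r))))) (sym (ℕ.+-identityʳ _))))

in𝔽₂⟨s⟩-inverse : ∀ {n d} → In𝔽₂⟨s⟩ (n , d) → ¬ n ≋ [] → In𝔽₂⟨s⟩ (d , n)
in𝔽₂⟨s⟩-inverse {n} {d} (_ , A , B , B≉0 , eq) n≉0 =
  (λ n≋0 → n≉0 (≈ₚ⇒≋ n≋0)) , B , A , A≉0 ,
  ≋⇒≈ₚ (swap n (numerator B) (denominator A) (numerator A) d (denominator B) (≈ₚ⇒≋ eq))
  where
  NA≉0 = numerator-of-A≉0 {n} {d} A B n≉0 (≉F0⇒numerator≉0 {evalAtS B} B≉0) (≈ₚ⇒≋ eq)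
  A≉0 : ¬ (evalAtS A F.≈ F.0#)
  A≉0 A≈0 = NA≉0 (≋-trans (≋-sym (*ₚ-identityʳ _)) (≈ₚ⇒≋ A≈0))
  swap : ∀ n NB DA NA d DB → ((n * NB) * DA) ≈ (NA * (d * DB)) → ((d * NA) * DB) ≈ (NB * (n * DA))
  swap n NB DA NA d DB eq = ≋-trans (lhs NA d DB) (≋-trans (≋-sym eq) (rhs n NB DA))
    where
    lhs : ∀ NA d DB → ((d * NA) * DB) ≈ (NA * (d * DB))
    lhs = solve-∀ 𝔽₂[t]-almostCommutativeRing
    rhs : ∀ n NB DA → ((n * NB) * DA) ≈ (NB * (n * DA))
    rhs = solve-∀ 𝔽₂[t]-almostCommutativeRing

-- The coefficients of G lie in 𝔽₂(s)

[1]≉0 : ¬ (evalAtS (true ∷ []) F.≈ F.0#)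
[1]≉0 ()

1∈𝔽₂⟨s⟩ : In𝔽₂⟨s⟩ F.1#
1∈𝔽₂⟨s⟩ = (λ ()) , true ∷ [] , true ∷ [] , [1]≉0 , ≋⇒≈ₚ (by-decision {(1ₚ *ₚ N) *ₚ D} {N *ₚ (1ₚ *ₚ D)} tt)
  where
  N = numerator (true ∷ [])
  D = denominator (true ∷ [])

-- Since evalAtS B has denominator t^(length B), an appended zero
-- multiplies its numerator by t.
pad : List Bool → List Bool
pad []      = false ∷ []
pad (b ∷ B) = b ∷ pad B

length-pad : ∀ B → length (pad B) ≡ suc (length B)
length-pad []      = refl
length-pad (b ∷ B) = cong suc (length-pad B)

length-+ₚ : ∀ (B B′ : List Bool) → length B ≡ length B′ → length (B +ₚ B′) ≡ length B
length-+ₚ []      []       _  = refl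
length-+ₚ (b ∷ B) (b′ ∷ B′) eq = cong suc (length-+ₚ B B′ (ℕ.suc-injective eq))

numerator-+ₚ : ∀ B B′ → length B ≡ length B′ → numerator (B +ₚ B′) ≋ (numerator B +ₚ numerator B′)
numerator-+ₚ []      []        _  = ≋-refl
numerator-+ₚ (b ∷ B) (b′ ∷ B′) eq = begin
  numerator ((b xor b′) ∷ (B +ₚ B′))
    ≈⟨ numerator-∷ (b xor b′) (B +ₚ B′) ⟩
  (((b xor b′) ∷ []) *ₚ (t ^ₚ suc (length (B +ₚ B′)))) +ₚ (proj₁ s *ₚ numerator (B +ₚ B′))
    ≈⟨ +ₚ-cong (*ₚ-cong (≋-refl {(b xor b′) ∷ []}) (t^-length (length-+ₚ B B′ eq′)))
               (*ₚ-cong (≋-refl {proj₁ s}) (numerator-+ₚ B B′ eq′)) ⟩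
  (((b xor b′) ∷ []) *ₚ T) +ₚ (proj₁ s *ₚ (numerator B +ₚ numerator B′))
    ≈⟨ regroup (b ∷ []) (b′ ∷ []) T (proj₁ s) (numerator B) (numerator B′) ⟩
  (((b ∷ []) *ₚ T) +ₚ (proj₁ s *ₚ numerator B)) +ₚ (((b′ ∷ []) *ₚ T) +ₚ (proj₁ s *ₚ numerator B′))
    ≈⟨ ≋-sym (+ₚ-cong (numerator-∷ b B)
                      (≋-trans (numerator-∷ b′ B′) (+ₚ-cong (*ₚ-cong (≋-refl {b′ ∷ []}) (t^-length (sym eq′)))
                                                            (≋-refl {proj₁ s *ₚ numerator B′})))) ⟩
  numerator (b ∷ B) +ₚ numerator (b′ ∷ B′) ∎
  where
  open ≋-Reasoning
  eq′ = ℕ.suc-injective eq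
  T = t ^ₚ suc (length B)
  t^-length : ∀ {m n} → m ≡ n → (t ^ₚ suc m) ≋ (t ^ₚ suc n)
  t^-length refl = ≋-refl
  regroup : ∀ x y T s u v → (((x + y) * T) + (s * (u + v))) ≈ (((x * T) + (s * u)) + ((y * T) + (s * v)))
  regroup = solve-∀ 𝔽₂[t]-almostCommutativeRing

numerator-pad : ∀ B → numerator (pad B) ≋ (t *ₚ numerator B)
numerator-pad []      = by-decision {numerator (false ∷ [])} {t *ₚ []} tt
numerator-pad (b ∷ B) = begin
  numerator (b ∷ pad B)
    ≈⟨ numerator-∷ b (pad B) ⟩
  ((b ∷ []) *ₚ (t ^ₚ suc (length (pad B)))) +ₚ (proj₁ s *ₚ numerator (pad B))
    ≈⟨ +ₚ-cong (*ₚ-cong (≋-refl {b ∷ []}) (≋-reflexive (cong (λ n → t ^ₚ suc n) (length-pad B))))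
               (*ₚ-cong (≋-refl {proj₁ s}) (numerator-pad B)) ⟩
  ((b ∷ []) *ₚ (t *ₚ T)) +ₚ (proj₁ s *ₚ (t *ₚ numerator B))
    ≈⟨ factor-t (b ∷ []) t T (proj₁ s) (numerator B) ⟩
  t *ₚ (((b ∷ []) *ₚ T) +ₚ (proj₁ s *ₚ numerator B))
    ≈⟨ *ₚ-cong (≋-refl {t}) (≋-sym (numerator-∷ b B)) ⟩
  t *ₚ numerator (b ∷ B) ∎
  where
  open ≋-Reasoning
  T = t ^ₚ suc (length B)
  factor-t : ∀ x t T s u → ((x * (t * T)) + (s * (t * u))) ≈ (t * ((x * T) + (s * u)))
  factor-t = solve-∀ 𝔽₂[t]-almostCommutativeRing

-- Coefficients of the Dickson polynomial D_r, with D_r(t + 1/t) = t^r + 1/t^r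
-- and D_(r+2) = X D_(r+1) - D_r (so D_0 = 0 in characteristic 2), padded to
-- length r + 1.
dickson : ℕ → List Bool
dickson zero          = false ∷ []
dickson (suc zero)    = false ∷ true ∷ []
dickson (suc (suc r)) = (false ∷ dickson (suc r)) +ₚ pad (pad (dickson r))

length-pad² : ∀ {B n} → length B ≡ n → length (pad (pad B)) ≡ suc (suc n)
length-pad² {B} refl = trans (length-pad (pad B)) (cong suc (length-pad B))

dickson-summands-length : ∀ {r} → length (dickson (suc r)) ≡ suc (suc r) → length (dickson r) ≡ suc r →
                          length (false ∷ dickson (suc r)) ≡ length (pad (pad (dickson r)))
dickson-summands-length {r} len₁ len₀ = trans (cong suc len₁) (sym (length-pad² {dickson r} len₀))

length-dickson : ∀ r → length (dickson r) ≡ suc r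
length-dickson zero          = refl
length-dickson (suc zero)    = refl
length-dickson (suc (suc r)) =
  trans (length-+ₚ (false ∷ dickson (suc r)) (pad (pad (dickson r)))
          (dickson-summands-length (length-dickson (suc r)) (length-dickson r)))
        (cong suc (length-dickson (suc r)))

numerator-dickson : ∀ r → numerator (dickson r) ≋ (t *ₚ (((t ^ₚ r) *ₚ (t ^ₚ r)) +ₚ 1ₚ))
numerator-dickson zero          = by-decision {numerator (dickson 0)} {t *ₚ ((1ₚ *ₚ 1ₚ) +ₚ 1ₚ)} tt
numerator-dickson (suc zero)    = by-decision {numerator (dickson 1)} {t *ₚ (((t *ₚ 1ₚ) *ₚ (t *ₚ 1ₚ)) +ₚ 1ₚ)} tt
numerator-dickson (suc (suc r)) = begin
  numerator ((false ∷ dickson (suc r)) +ₚ pad (pad (dickson r)))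
    ≈⟨ numerator-+ₚ (false ∷ dickson (suc r)) (pad (pad (dickson r)))
                    (dickson-summands-length (length-dickson (suc r)) (length-dickson r)) ⟩
  numerator (false ∷ dickson (suc r)) +ₚ numerator (pad (pad (dickson r)))
    ≈⟨ +ₚ-cong (≋-trans (numerator-false∷ (dickson (suc r))) (*ₚ-cong (≋-refl {proj₁ s}) (numerator-dickson (suc r))))
               (≋-trans (numerator-pad (pad (dickson r)))
                  (*ₚ-cong (≋-refl {t})
                    (≋-trans (numerator-pad (dickson r)) (*ₚ-cong (≋-refl {t}) (numerator-dickson r))))) ⟩
  (proj₁ s *ₚ (t *ₚ ((tT *ₚ tT) +ₚ 1ₚ))) +ₚ (t *ₚ (t *ₚ (t *ₚ ((T *ₚ T) +ₚ 1ₚ))))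
    ≈⟨ +ₚ-cong (≋-refl {proj₁ s *ₚ (t *ₚ ((tT *ₚ tT) +ₚ 1ₚ))}) (≋-sym (-ₚ≋id _)) ⟩
  (proj₁ s *ₚ (t *ₚ ((tT *ₚ tT) +ₚ 1ₚ))) +ₚ (-ₚ (t *ₚ (t *ₚ (t *ₚ ((T *ₚ T) +ₚ 1ₚ)))))
    ≈⟨ recurrence t T ⟩
  t *ₚ (((t *ₚ tT) *ₚ (t *ₚ tT)) +ₚ 1ₚ) ∎
  where
  open ≋-Reasoning
  T = t ^ₚ r
  tT = t *ₚ T
  recurrence : ∀ t T → ((((t * t) + 1#) * (t * (((t * T) * (t * T)) + 1#))) - (t * (t * (t * ((T * T) + 1#)))))
                       ≈ (t * (((t * (t * T)) * (t * (t * T))) + 1#))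
  recurrence = solve-∀ 𝔽₂[t]-almostCommutativeRing

t^r+t^-r∈𝔽₂⟨s⟩ : ∀ r → In𝔽₂⟨s⟩ (((t ^ₚ (2 *ℕ r)) +ₚ 1ₚ) , (t ^ₚ r))
t^r+t^-r∈𝔽₂⟨s⟩ r =
  (λ T≈0 → weight⇒nonzero (t^-weight r) (≈ₚ⇒≋ T≈0)) , dickson r , true ∷ [] , [1]≉0 , ≋⇒≈ₚ (begin
    ((S +ₚ 1ₚ) *ₚ numerator (true ∷ [])) *ₚ denominator (dickson r)
      ≈⟨ *ₚ-cong (*ₚ-cong (+ₚ-cong (t^-double r) (≋-refl {1ₚ})) N₁≋t)
                 (≋-trans (denominator-t^ (dickson r)) (≋-reflexive (cong (t ^ₚ_) (length-dickson r)))) ⟩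
    (((T *ₚ T) +ₚ 1ₚ) *ₚ t) *ₚ (t *ₚ T)
      ≈⟨ rearrange (T *ₚ T) t T ⟩
    (t *ₚ ((T *ₚ T) +ₚ 1ₚ)) *ₚ (T *ₚ t)
      ≈⟨ *ₚ-cong (≋-sym (numerator-dickson r)) (*ₚ-cong (≋-refl {T}) (≋-sym D₁≋t)) ⟩
    numerator (dickson r) *ₚ (T *ₚ denominator (true ∷ [])) ∎)
  where
  open ≋-Reasoning
  S = t ^ₚ (2 *ℕ r)
  T = t ^ₚ r
  N₁≋t : numerator (true ∷ []) ≋ t
  N₁≋t = by-decision {numerator (true ∷ [])} {t} tt
  D₁≋t : denominator (true ∷ []) ≋ t
  D₁≋t = by-decision {denominator (true ∷ [])} {t} tt
  rearrange : ∀ S t T → (((S + 1#) * t) * (t * T)) ≈ ((t * (S + 1#)) * (T * t))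
  rearrange = solve-∀ 𝔽₂[t]-almostCommutativeRing

-- The field 𝔽₂(t)

𝔽₂⟨t⟩-isPartialDomain : IsPartialDomain 𝔽₂⟨t⟩ ValidF
𝔽₂⟨t⟩-isPartialDomain = record
  { ≈-refl = ≋⇒≈ₚ ≋-refl
  ; ≈-sym = λ e → ≋⇒≈ₚ (≋-sym (≈ₚ⇒≋ e))
  ; ≈-trans = λ {x} {y} {z} → ≈-trans {x} {y} {z}
  ; +-cong = λ {x} {x′} {y} {y′} → +-cong {x} {x′} {y} {y′}
  ; *-cong = λ {x} {x′} {y} {y′} → *-cong {x} {x′} {y} {y′}
  ; valid-0# = λ ()
  ; valid-+ = λ {x} {y} → valid-× {x} {y}
  ; valid-* = λ {x} {y} → valid-× {x} {y}
  ; +-identityˡ = λ (a , b) → ≋⇒≈ₚ (+-identityˡ a b)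
  ; +-identityʳ = λ (a , b) → ≋⇒≈ₚ (+-identityʳ a b)
  ; zeroˡ = λ (a , b) → ≋⇒≈ₚ (zeroˡ a b)
  ; zeroʳ = λ (a , b) → ≋⇒≈ₚ (zeroʳ a b)
  ; *-nonzero = λ {x} {y} _ _ x≉0 y≉0 xy≈0 →
      *ₚ-nonzero (≉F0⇒numerator≉0 {x} x≉0) (≉F0⇒numerator≉0 {y} y≉0) (≈F0⇒numerator≋0 {x F.* y} xy≈0)
  ; ≈0? = λ (a , b) → map′ ≋⇒≈ₚ ≈ₚ⇒≋ (≋[]? (a *ₚ 1ₚ)) }
  where
  valid-× : ∀ {x y} → ValidF x → ValidF y → ¬ (proj₂ x *ₚ proj₂ y) T.≈ₚ []
  valid-× {x} {y} vx vy b≈0 =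
    *ₚ-nonzero (ValidF⇒denominator≉0 {x} vx) (ValidF⇒denominator≉0 {y} vy) (≈ₚ⇒≋ b≈0)

  ≈-trans : ∀ {x y z} → ValidF y → x F.≈ y → y F.≈ z → x F.≈ z
  ≈-trans {a , b} {c , d} {e , f} vy ad≈cb cf≈ed = ≋⇒≈ₚ (*ₚ-cancelʳ (ValidF⇒denominator≉0 {c , d} vy) (begin
    (a *ₚ f) *ₚ d ≈⟨ swap a f d ⟩
    (a *ₚ d) *ₚ f ≈⟨ *ₚ-cong (≈ₚ⇒≋ ad≈cb) (≋-refl {f}) ⟩
    (c *ₚ b) *ₚ f ≈⟨ swap c b f ⟩
    (c *ₚ f) *ₚ b ≈⟨ *ₚ-cong (≈ₚ⇒≋ cf≈ed) (≋-refl {b}) ⟩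
    (e *ₚ d) *ₚ b ≈⟨ swap e d b ⟩
    (e *ₚ b) *ₚ d ∎))
    where
    open ≋-Reasoning
    swap : ∀ x y z → ((x * y) * z) ≈ ((x * z) * y)
    swap = solve-∀ 𝔽₂[t]-almostCommutativeRing

  +-cong : ∀ {x x′ y y′} → x F.≈ x′ → y F.≈ y′ → (x F.+ y) F.≈ (x′ F.+ y′)
  +-cong {a , b} {a′ , b′} {c , d} {c′ , d′} ab′≈a′b cd′≈c′d = ≋⇒≈ₚ (begin
    ((a *ₚ d) +ₚ (c *ₚ b)) *ₚ (b′ *ₚ d′)
      ≈⟨ expand a b c d b′ d′ ⟩
    ((a *ₚ b′) *ₚ (d *ₚ d′)) +ₚ ((c *ₚ d′) *ₚ (b *ₚ b′))
      ≈⟨ +ₚ-cong (*ₚ-cong (≈ₚ⇒≋ ab′≈a′b) (≋-refl {d *ₚ d′})) (*ₚ-cong (≈ₚ⇒≋ cd′≈c′d) (≋-refl {b *ₚ b′})) ⟩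
    ((a′ *ₚ b) *ₚ (d *ₚ d′)) +ₚ ((c′ *ₚ d) *ₚ (b *ₚ b′))
      ≈⟨ ≋-sym (expand′ a′ b′ c′ d′ b d) ⟩
    ((a′ *ₚ d′) +ₚ (c′ *ₚ b′)) *ₚ (b *ₚ d) ∎)
    where
    open ≋-Reasoning
    expand : ∀ a b c d b′ d′ → (((a * d) + (c * b)) * (b′ * d′)) ≈ (((a * b′) * (d * d′)) + ((c * d′) * (b * b′)))
    expand = solve-∀ 𝔽₂[t]-almostCommutativeRing
    expand′ : ∀ a′ b′ c′ d′ b d → (((a′ * d′) + (c′ * b′)) * (b * d)) ≈ (((a′ * b) * (d * d′)) + ((c′ * d) * (b * b′)))
    expand′ = solve-∀ 𝔽₂[t]-almostCommutativeRing

  *-cong : ∀ {x x′ y y′} → x F.≈ x′ → y F.≈ y′ → (x F.* y) F.≈ (x′ F.* y′)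
  *-cong {a , b} {a′ , b′} {c , d} {c′ , d′} ab′≈a′b cd′≈c′d = ≋⇒≈ₚ
    (≋-trans (regroup a c b′ d′) (≋-trans (*ₚ-cong (≈ₚ⇒≋ ab′≈a′b) (≈ₚ⇒≋ cd′≈c′d)) (≋-sym (regroup a′ c′ b d))))
    where
    regroup : ∀ a c b′ d′ → ((a * c) * (b′ * d′)) ≈ ((a * b′) * (c * d′))
    regroup = solve-∀ 𝔽₂[t]-almostCommutativeRing

  +-identityˡ : ∀ a b → (((0# * b) + (a * 1#)) * b) ≈ (a * (1# * b))
  +-identityˡ = solve-∀ 𝔽₂[t]-almostCommutativeRing
  +-identityʳ : ∀ a b → (((a * 1#) + (0# * b)) * b) ≈ (a * (b * 1#))
  +-identityʳ = solve-∀ 𝔽₂[t]-almostCommutativeRing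
  zeroˡ : ∀ a b → ((0# * a) * 1#) ≈ (0# * (1# * b))
  zeroˡ = solve-∀ 𝔽₂[t]-almostCommutativeRing
  zeroʳ : ∀ a b → ((a * 0#) * 1#) ≈ (0# * (b * 1#))
  zeroʳ = solve-∀ 𝔽₂[t]-almostCommutativeRing

module YPoly = Polynomials 𝔽₂⟨t⟩-isPartialDomain

-- Irreducibility of G

-- x = n/d and y = m/e with x y = 1 and x + y = (S + 1)/T = T + 1/T
-- are the roots T and 1/T; cleared of denominators:
reciprocal-roots : ∀ {n d m e S T} → (n *ₚ m) ≋ (d *ₚ e) → ((S +ₚ 1ₚ) *ₚ (d *ₚ e)) ≋ (((n *ₚ e) +ₚ (m *ₚ d)) *ₚ T) →
                   S ≋ (T *ₚ T) → (e *ₚ (((n * T) - d) * (n - (d * T)))) ≋ []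
reciprocal-roots {n} {d} {m} {e} {S} {T} nm≋de sum≋ S≋T² = begin
  e * (((n * T) - d) * (n - (d * T)))
    ≈⟨ expand n d m e S T ⟩
  (((- n) * (((S + 1#) * (d * e)) - (((n * e) + (m * d)) * T))) + ((d * T) * ((d * e) - (n * m))))
    + ((n * (d * e)) * (S - (T * T)))
    ≈⟨ +ₚ-cong (+ₚ-cong (*ₚ-cong (≋-refl { - n}) (+ₚ-Group.x≈y⇒x∙y⁻¹≈ε sum≋))
                        (*ₚ-cong (≋-refl {d * T}) (+ₚ-Group.x≈y⇒x∙y⁻¹≈ε (≋-sym nm≋de))))
               (*ₚ-cong (≋-refl {n * (d * e)}) (+ₚ-Group.x≈y⇒x∙y⁻¹≈ε S≋T²)) ⟩
  (((- n) * 0#) + ((d * T) * 0#)) + ((n * (d * e)) * 0#)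
    ≈⟨ vanish (- n) (d * T) (n * (d * e)) ⟩
  0# ∎
  where
  open ≋-Reasoning
  expand : ∀ n d m e S T → (e * (((n * T) - d) * (n - (d * T)))) ≈
    ((((- n) * (((S + 1#) * (d * e)) - (((n * e) + (m * d)) * T))) + ((d * T) * ((d * e) - (n * m))))
      + ((n * (d * e)) * (S - (T * T))))
  expand = solve-∀ 𝔽₂[t]-almostCommutativeRing
  vanish : ∀ a b c → (((a * 0#) + (b * 0#)) + (c * 0#)) ≈ 0#
  vanish = solve-∀ 𝔽₂[t]-almostCommutativeRing


G-linear-factor-equations : ∀ {r n₀ d₀ n₁ d₁ m₀ e₀ m₁ e₁} →
  G r YPoly.≋ (((n₀ , d₀) ∷ (n₁ , d₁) ∷ []) Y.*ₚ ((m₀ , e₀) ∷ (m₁ , e₁) ∷ [])) →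
  (n₀ *ₚ m₀) ≋ (d₀ *ₚ e₀) ×
  (((t ^ₚ (2 *ℕ r)) +ₚ 1ₚ) *ₚ ((d₀ *ₚ e₁) *ₚ (d₁ *ₚ e₀)))
    ≋ ((((n₀ *ₚ m₁) *ₚ (d₁ *ₚ e₀)) +ₚ ((n₁ *ₚ m₀) *ₚ (d₀ *ₚ e₁))) *ₚ (t ^ₚ r)) ×
  (n₁ *ₚ m₁) ≋ (d₁ *ₚ e₁)
G-linear-factor-equations {r} {n₀} {d₀} {n₁} {d₁} {m₀} {e₀} {m₁} {e₁} G≋AB =
  ≋-trans (≋-sym (constant-rhs n₀ m₀ d₀ e₀)) (≋-trans (≋-sym (≈ₚ⇒≋ (YPoly.at G≋AB 0))) (constant-lhs d₀ e₀)) ,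
  ≋-trans (≋-sym (middle-lhs (t ^ₚ (2 *ℕ r)) d₀ e₁ d₁ e₀))
    (≋-trans (≈ₚ⇒≋ (YPoly.at G≋AB 1)) (middle-rhs (t ^ₚ r) n₀ m₁ d₀ e₁ n₁ m₀ d₁ e₀)) ,
  ≋-trans (≋-sym (*ₚ-identityʳ _)) (≋-trans (≋-sym (≈ₚ⇒≋ (YPoly.at G≋AB 2))) (*ₚ-identityˡ _))
  where
  constant-rhs : ∀ n₀ m₀ d₀ e₀ → ((((n₀ * m₀) * 1#) + (0# * (d₀ * e₀))) * 1#) ≈ (n₀ * m₀)
  constant-rhs = solve-∀ 𝔽₂[t]-almostCommutativeRing
  constant-lhs : ∀ d₀ e₀ → (1# * ((d₀ * e₀) * 1#)) ≈ (d₀ * e₀)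
  constant-lhs = solve-∀ 𝔽₂[t]-almostCommutativeRing
  middle-lhs : ∀ S d₀ e₁ d₁ e₀ → ((S + 1#) * ((d₀ * e₁) * ((d₁ * e₀) * 1#))) ≈ ((S + 1#) * ((d₀ * e₁) * (d₁ * e₀)))
  middle-lhs = solve-∀ 𝔽₂[t]-almostCommutativeRing
  middle-rhs : ∀ T n₀ m₁ d₀ e₁ n₁ m₀ d₁ e₀ →
    ((((n₀ * m₁) * ((d₁ * e₀) * 1#)) + ((((n₁ * m₀) * 1#) + (0# * (d₁ * e₀))) * (d₀ * e₁))) * T)
    ≈ ((((n₀ * m₁) * (d₁ * e₀)) + ((n₁ * m₀) * (d₀ * e₁))) * T)
  middle-rhs = solve-∀ 𝔽₂[t]-almostCommutativeRing

linear-factors⇒a₀b₁≈t^±r : ∀ {r n₀ d₀ n₁ d₁ m₀ e₀ m₁ e₁} → ¬ d₁ ≋ [] → ¬ e₀ ≋ [] →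
  G r YPoly.≋ (((n₀ , d₀) ∷ (n₁ , d₁) ∷ []) Y.*ₚ ((m₀ , e₀) ∷ (m₁ , e₁) ∷ [])) →
  (d₀ *ₚ e₁) ≋ ((n₀ *ₚ m₁) *ₚ (t ^ₚ r)) ⊎ (n₀ *ₚ m₁) ≋ ((d₀ *ₚ e₁) *ₚ (t ^ₚ r))
linear-factors⇒a₀b₁≈t^±r {r} {n₀} {d₀} {n₁} {d₁} {m₀} {e₀} {m₁} {e₁} d₁≉0 e₀≉0 G≋AB =
  Sum.map (λ nT-d≋0 → ≋-sym (+ₚ-Group.x∙y⁻¹≈ε⇒x≈y (n *ₚ T) d nT-d≋0)) (+ₚ-Group.x∙y⁻¹≈ε⇒x≈y n (d *ₚ T))
    (zero-product (cancel-e (reciprocal-roots {n} {d} {m} {e} nm≋de middle (t^-double r))))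
  where
  n = n₀ *ₚ m₁
  d = d₀ *ₚ e₁
  m = n₁ *ₚ m₀
  e = d₁ *ₚ e₀
  T = t ^ₚ r
  equations = G-linear-factor-equations {r} {n₀} {d₀} {n₁} {d₁} {m₀} {e₀} {m₁} {e₁} G≋AB
  middle = proj₁ (proj₂ equations)
  nm≋de : (n *ₚ m) ≋ (d *ₚ e)
  nm≋de = ≋-trans (regroup n₀ m₁ n₁ m₀)
            (≋-trans (*ₚ-cong (proj₁ equations) (proj₂ (proj₂ equations))) (regroup d₀ e₀ d₁ e₁))
    where
    regroup : ∀ a b c d → ((a * b) * (c * d)) ≈ ((a * d) * (c * b))
    regroup = solve-∀ 𝔽₂[t]-almostCommutativeRing
  cancel-e : ∀ {x} → (e *ₚ x) ≋ [] → x ≋ []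
  cancel-e ex≋0 = [ (λ e≋0 → ⊥-elim (*ₚ-nonzero d₁≉0 e₀≉0 e≋0)) , (λ x≋0 → x≋0) ] (zero-product ex≋0)

in𝔽₂⟨s⟩-product-balanced : ∀ {x y} → In𝔽₂⟨s⟩ x → In𝔽₂⟨s⟩ y → ¬ proj₁ (x F.* y) ≋ [] → Balanced (x F.* y)
in𝔽₂⟨s⟩-product-balanced {n , d} {m , e} x∈ y∈ nm≉0 =
  balanced-* (in𝔽₂⟨s⟩⇒balanced x∈ (λ n≋0 → nm≉0 (TPoly.*ₚ-zeroˡ (all-⊤ n) (all-⊤ m) n≋0)))
             (in𝔽₂⟨s⟩⇒balanced y∈ (λ m≋0 → nm≉0 (TPoly.*ₚ-zeroʳ (all-⊤ n) (all-⊤ m) m≋0)))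

linear-factors⇒r≡0 : ∀ {r a₀ a₁ b₀ b₁} → In𝔽₂⟨s⟩ a₀ → ValidF a₁ → ValidF b₀ → In𝔽₂⟨s⟩ b₁ →
  G r YPoly.≋ ((a₀ ∷ a₁ ∷ []) Y.*ₚ (b₀ ∷ b₁ ∷ [])) → r ≡ 0
linear-factors⇒r≡0 {r} {n₀ , d₀} {n₁ , d₁} {m₀ , e₀} {m₁ , e₁} a₀∈ va₁ vb₀ b₁∈ G≋ab =
  conclude (linear-factors⇒a₀b₁≈t^±r {r} {n₀} {d₀} {n₁} {d₁} {m₀} {e₀} {m₁} {e₁}
             (ValidF⇒denominator≉0 {n₁ , d₁} va₁) (ValidF⇒denominator≉0 {m₀ , e₀} vb₀) G≋ab)
  where
  d≉0 : ¬ (d₀ *ₚ e₁) ≋ []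
  d≉0 = *ₚ-nonzero (ValidF⇒denominator≉0 {n₀ , d₀} (proj₁ a₀∈)) (ValidF⇒denominator≉0 {m₁ , e₁} (proj₁ b₁∈))
  balanced : ¬ (n₀ *ₚ m₁) ≋ [] → Balanced ((n₀ , d₀) F.* (m₁ , e₁))
  balanced = in𝔽₂⟨s⟩-product-balanced {n₀ , d₀} {m₁ , e₁} a₀∈ b₁∈
  conclude : (d₀ *ₚ e₁) ≋ ((n₀ *ₚ m₁) *ₚ (t ^ₚ r)) ⊎ (n₀ *ₚ m₁) ≋ ((d₀ *ₚ e₁) *ₚ (t ^ₚ r)) → r ≡ 0
  conclude (inj₁ d≋nT) =
    let (_ , Wn , Wd) = balanced λ n≋0 → d≉0 (≋-trans d≋nT (TPoly.*ₚ-zeroˡ (all-⊤ _) (all-⊤ _) n≋0))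
    in same-weight-×t^r⇒r≡0 Wd Wn d≋nT
  conclude (inj₂ n≋dT) =
    let (_ , Wn , Wd) = balanced λ n≋0 → *ₚ-nonzero d≉0 (weight⇒nonzero (t^-weight r)) (≋-trans (≋-sym n≋dT) n≋0)
    in same-weight-×t^r⇒r≡0 Wn Wd n≋dT

validOf : ∀ {p} → All In𝔽₂⟨s⟩ p → All ValidF p
validOf = All.map proj₁

1≉0 : ¬ (F.1# F.≈ F.0#)
1≉0 (() , _)

degree-G : ∀ r → YPoly.Degree (G r) 2
degree-G r = 1≉0 , YPoly.≋-refl

G-coefficients∈𝔽₂⟨s⟩ : ∀ r → Y.InPolyOver In𝔽₂⟨s⟩ (G r)
G-coefficients∈𝔽₂⟨s⟩ r = 1∈𝔽₂⟨s⟩ ∷ t^r+t^-r∈𝔽₂⟨s⟩ r ∷ 1∈𝔽₂⟨s⟩ ∷ []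

constant⇒unit : ∀ {a} → All In𝔽₂⟨s⟩ a → YPoly.Degree a 0 → Y.IsUnit In𝔽₂⟨s⟩ a
constant⇒unit {(n , d) ∷ rest} (x∈ ∷ rest∈) (x≉0 , rest≋0) =
  ((d , n) ∷ []) , (x⁻¹∈ ∷ []) , ≋⇒≈ₚ (x*x⁻¹ n d) ,
  YPoly.≋⇒≈ₚ (YPoly.*ₚ-zeroˡ (validOf rest∈) (proj₁ x⁻¹∈ ∷ []) rest≋0)
  where
  x⁻¹∈ = in𝔽₂⟨s⟩-inverse x∈ (≉F0⇒numerator≉0 {n , d} x≉0)
  x*x⁻¹ : ∀ n d → ((((n * d) * 1#) + (0# * (d * n))) * 1#) ≈ (1# * ((d * n) * 1#))
  x*x⁻¹ = solve-∀ 𝔽₂[t]-almostCommutativeRing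

degree-1-factors⇒r≡0 : ∀ {r a b} → Y.InPolyOver In𝔽₂⟨s⟩ a → Y.InPolyOver In𝔽₂⟨s⟩ b →
                       YPoly.Degree a 1 → YPoly.Degree b 1 → G r YPoly.≋ (a Y.*ₚ b) → r ≡ 0
degree-1-factors⇒r≡0 {r} {a₀ ∷ a₁ ∷ _} {b₀ ∷ b₁ ∷ _} a∈@(a₀∈ ∷ a₁∈ ∷ _) b∈@(b₀∈ ∷ b₁∈ ∷ _)
                     (_ , ra≋0) (_ , rb≋0) G≋ab =
  linear-factors⇒r≡0 {r} {a₀} {a₁} {b₀} {b₁} a₀∈ (proj₁ a₁∈) (proj₁ b₀∈) b₁∈
    (YPoly.≋-trans (YPoly.valid-*ₚ (validOf a∈) (validOf b∈)) G≋ab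
      (YPoly.*ₚ-cong {p′ = a₀ ∷ a₁ ∷ []} {q′ = b₀ ∷ b₁ ∷ []}
         (validOf a∈) (proj₁ a₀∈ ∷ proj₁ a₁∈ ∷ []) (validOf b∈) (proj₁ b₀∈ ∷ proj₁ b₁∈ ∷ [])
        (YPoly.∷-cong (≈F-refl {a₀}) (YPoly.∷-cong (≈F-refl {a₁}) ra≋0))
        (YPoly.∷-cong (≈F-refl {b₀}) (YPoly.∷-cong (≈F-refl {b₁}) rb≋0))))
  where
  open IsPartialDomain 𝔽₂⟨t⟩-isPartialDomain using () renaming (≈-refl to ≈F-refl)

G-not-unit : ∀ r → ¬ Y.IsUnit In𝔽₂⟨s⟩ (G r)
G-not-unit r (h , h∈ , Gh≈1)
  with YPoly.factor-degrees {n = 0} ((λ ()) ∷ []) (validOf (G-coefficients∈𝔽₂⟨s⟩ r)) (validOf h∈)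
         (YPoly.≋-sym (YPoly.≈ₚ⇒≋ Gh≈1)) (1≉0 , YPoly.≋-refl {[]})
... | (d , _ , deg-G , _ , d+e≡0) with YPoly.degree-unique {G r} {2} {d} (degree-G r) deg-G
...   | refl with d+e≡0
...     | ()

G-factor⇒unit : ∀ r → r ≢ 0 → ∀ a b → Y.InPolyOver In𝔽₂⟨s⟩ a → Y.InPolyOver In𝔽₂⟨s⟩ b →
                G r Y.≈ₚ (a Y.*ₚ b) → Y.IsUnit In𝔽₂⟨s⟩ a ⊎ Y.IsUnit In𝔽₂⟨s⟩ b
G-factor⇒unit r r≢0 a b a∈ b∈ G≈ab
  with YPoly.factor-degrees (validOf (G-coefficients∈𝔽₂⟨s⟩ r)) (validOf a∈) (validOf b∈)
         (YPoly.≈ₚ⇒≋ G≈ab) (degree-G r)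
... | (d , e , deg-a , deg-b , d+e≡2) = by-degrees d e deg-a deg-b d+e≡2
  where
  by-degrees : ∀ d e → YPoly.Degree a d → YPoly.Degree b e → d +ℕ e ≡ 2 →
               Y.IsUnit In𝔽₂⟨s⟩ a ⊎ Y.IsUnit In𝔽₂⟨s⟩ b
  by-degrees zero                e             deg-a _     _  = inj₁ (constant⇒unit a∈ deg-a)
  by-degrees (suc _)             zero          _     deg-b _  = inj₂ (constant⇒unit b∈ deg-b)
  by-degrees 1                   1             deg-a deg-b _  =
    ⊥-elim (r≢0 (degree-1-factors⇒r≡0 a∈ b∈ deg-a deg-b (YPoly.≈ₚ⇒≋ G≈ab)))
  by-degrees 1                   (suc (suc _)) _     _     ()
  by-degrees (suc (suc zero))    (suc _)       _     _     ()
  by-degrees (suc (suc (suc _))) (suc _)       _     _     ()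

mainTheorem7 : (r : ℕ) → 3 ≤ r → r % 2 ≡ 1 →
    Y.InPolyOver In𝔽₂⟨s⟩ (G r) × Y.Irreducible In𝔽₂⟨s⟩ (G r)
mainTheorem7 r 3≤r _ =
  G-coefficients∈𝔽₂⟨s⟩ r ,
  (λ G≈0 → 1≉0 (proj₁ G≈0)) ,
  G-not-unit r ,
  G-factor⇒unit r (ℕ.m<n⇒n≢0 {2} 3≤r)
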